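{- Let $k\geq 5$ and $0\leq \alpha\leq k-2$ be integers. Let $A$ be a set of $k$ nonnegative integers with $0\in A$ such that \[|\Sigma_{\alpha}(A)|=\frac{(k-1)k}{2}-\frac{(\alpha-1)\alpha}{2}+1.\] Then $A=d*[0,k-1]$ for some positive integer $d$.
   Context: For a finite set $A$ of integers with $|A|=k$ and an integer $0\leq\alpha\leq k$, $\Sigma_{\alpha}(A)=\{s(B): B\subseteq A,\ |B|\geq \alpha\}$, where $s(B)=\sum_{b\in B} b$ and $s(\emptyset)=0$. For integers $a\leq b$, $[a,b]=\{a,a+1,\ldots,b\}$, and for an integer $d$ and a set $X$, $d*X=\{dx: x\in X\}$. -}

module Defs where

open import Data.Nat using (ℕ; zero; suc; _+_; _*_; _≤_)
open import Data.Bool using (Bool; true; false)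
open import Data.Vec using (Vec; []; _∷_)
open import Data.Fin.Subset using (Subset; ∣_∣)
open import Data.List using (List; length)
open import Data.List.Relation.Unary.Unique.Propositional using (Unique)
open import Data.List.Membership.Propositional using (_∈_)
open import Data.Product using (Σ; _×_)
open import Function.Bundles using (_⇔_)
open import Relation.Binary.PropositionalEquality using (_≡_)

subsetSum : ∀ {k} → Vec ℕ k → Subset k → ℕ
subsetSum [] [] = 0
subsetSum (a ∷ as) (true ∷ bs) = a + subsetSum as bs
subsetSum (a ∷ as) (false ∷ bs) = subsetSum as bs

InSigma : ∀ {k} → ℕ → Vec ℕ k → ℕ → Set
InSigma {k} α A x = Σ (Subset k) λ B → (α ≤ ∣ B ∣) × (subsetSum A B ≡ x)

HasCard : (ℕ → Set) → ℕ → Set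
HasCard P n = Σ (List ℕ) λ L → Unique L × (length L ≡ n) × (∀ x → (x ∈ L) ⇔ P x)

-- List A increasingly as 0 = b 0 < b 1 < … < b n (n = k - 1). As 0 ∈ A,
-- Σ_α(A) = Σ_β(b 1, …, b n) with β = α - 1. With total m = b 1 + … + b m, the
-- numbers total β and total m - b i (β < m ≤ n, i < m) lie in Σ_β and are
-- distinct, since the block {total m - b i | i < m} lies above total (m - 1).
-- This chain has triangle n - triangle β + 1 elements, so by hypothesis it is
-- all of Σ_β. Removing two terms b i, b j (1 ≤ i < j ≤ n) from the total gives
-- an element of Σ_β; when b i + b j < b (n - 1) + b n it lies in one of the last
-- two blocks, so b i + b j is a term b l or b n + b l. Applied to b 1 + b j this
-- gives b (j + 1) = b j + b 1 for 2 ≤ j < n, applied to b 2 + b (n - 1) it gives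
-- b 2 = 2 b 1; hence b i = i b 1.
module Submission where

open import Defs
open import Data.Nat using (ℕ; zero; suc; _+_; _*_; _∸_; _/_; _≤_; _<_; z≤n; s≤s)
open import Data.Nat.Properties
open import Data.Nat.DivMod using (m*n/n≡m)
open import Data.Nat.ListAction using (sum)
open import Algebra.Properties.CommutativeSemigroup +-commutativeSemigroup using (x∙yz≈y∙xz)
open import Data.Bool using (true; false)
open import Data.Product using (Σ; ∃; _×_; _,_)
open import Data.Sum using (_⊎_; inj₁; inj₂)
open import Data.Empty using (⊥-elim)
open import Relation.Nullary using (yes; no; ¬_)
open import Relation.Binary using (tri<; tri≈; tri>)
open import Relation.Binary.PropositionalEquality hiding ([_])
open import Function.Bundles using (_⇔_; mk⇔; Equivalence)
open import Function.Properties.Equivalence using () renaming (trans to ⇔-trans)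
open import Data.Fin.Subset using (Subset; ∣_∣)
open import Data.Vec using (Vec; []; _∷_; toList)
open import Data.Vec.Properties using (length-toList)
open import Data.Vec.Relation.Unary.AllPairs as AllPairs using (AllPairs)
import Data.Vec.Relation.Unary.All.Properties as VecAll
open import Data.Vec.Membership.Propositional using (_∈_)
open import Data.Vec.Membership.Propositional.Properties using (∈-toList⁺; ∈-toList⁻)
open import Data.List using (List; []; _∷_; length; _++_; [_]; applyUpTo; applyDownFrom)
open import Data.List.Properties using (length-++; length-applyDownFrom; reverse-applyUpTo)
open import Data.List.Relation.Unary.Any using (here; there)
open import Data.List.Relation.Unary.All as All using ([]; _∷_)
open import Data.List.Relation.Unary.AllPairs using ([]; _∷_)
open import Data.List.Relation.Unary.Linked using (Linked; _∷_)
open import Data.List.Relation.Unary.Unique.Propositional using (Unique)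
open import Data.List.Relation.Unary.Unique.Propositional.Properties using (++⁺)
open import Data.List.Membership.Propositional using () renaming (_∈_ to _∈ₗ_)
open import Data.List.Membership.Propositional.Properties
  using (∈-∃++; ∈-++⁻; ∈-++⁺ˡ; ∈-++⁺ʳ; ∈-applyDownFrom⁺; ∈-applyDownFrom⁻; ∈-applyUpTo⁺; ∈-applyUpTo⁻)
open import Data.List.Membership.DecPropositional _≟_ using () renaming (_∈?_ to _∈ₗ?_)
open import Data.List.Relation.Binary.Permutation.Propositional as Perm using (_↭_; prep; swap; ↭⇒↭ₛ)
open import Data.List.Relation.Binary.Permutation.Propositional.Properties using (Any-resp-↭; ↭-length; ↭-reverse)
open import Data.List.Relation.Binary.Permutation.Setoid.Properties (setoid ℕ) using (Unique-resp-↭)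
open import Data.List.Sort ≤-decTotalOrder using (sort; sort-↭; sort-↗)

data SubSum : List ℕ → ℕ → ℕ → Set where
  none : SubSum [] 0 0
  skip : ∀ {x xs c s} → SubSum xs c s → SubSum (x ∷ xs) c s
  take : ∀ {x xs c s} → SubSum xs c s → SubSum (x ∷ xs) (suc c) (x + s)

Sigma : ℕ → List ℕ → ℕ → Set
Sigma β xs s = ∃ λ c → β ≤ c × SubSum xs c s

subset→SubSum : ∀ {k} (A : Vec ℕ k) (B : Subset k) → SubSum (toList A) ∣ B ∣ (subsetSum A B)
subset→SubSum [] [] = none
subset→SubSum (a ∷ as) (true ∷ B) = take (subset→SubSum as B)
subset→SubSum (a ∷ as) (false ∷ B) = skip (subset→SubSum as B)

SubSum→subset : ∀ {k} (A : Vec ℕ k) {c s} → SubSum (toList A) c s →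
                Σ (Subset k) λ B → ∣ B ∣ ≡ c × subsetSum A B ≡ s
SubSum→subset [] none = [] , refl , refl
SubSum→subset (a ∷ as) (skip p) with B , c≡ , s≡ ← SubSum→subset as p = false ∷ B , c≡ , s≡
SubSum→subset (a ∷ as) (take p) with B , c≡ , s≡ ← SubSum→subset as p =
  true ∷ B , cong suc c≡ , cong (a +_) s≡

SubSum-resp-↭ : ∀ {xs ys c s} → xs ↭ ys → SubSum xs c s → SubSum ys c s
SubSum-resp-↭ Perm.refl p = p
SubSum-resp-↭ (prep x q) (skip p) = skip (SubSum-resp-↭ q p)
SubSum-resp-↭ (prep x q) (take p) = take (SubSum-resp-↭ q p)
SubSum-resp-↭ (swap x y q) (skip (skip p)) = skip (skip (SubSum-resp-↭ q p))
SubSum-resp-↭ (swap x y q) (skip (take p)) = take (skip (SubSum-resp-↭ q p))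
SubSum-resp-↭ (swap x y q) (take (skip p)) = skip (take (SubSum-resp-↭ q p))
SubSum-resp-↭ (swap x y q) (take (take {s = s} p)) =
  subst (SubSum _ _) (x∙yz≈y∙xz y x s) (take (take (SubSum-resp-↭ q p)))
SubSum-resp-↭ (Perm.trans q r) p = SubSum-resp-↭ r (SubSum-resp-↭ q p)

-- An entry 0 can be added to or removed from any selection without changing
-- its sum, so it lowers the size constraint by one: Σ_α(0 ∷ xs) = Σ_{α-1}(xs).
Sigma-zero : ∀ α xs s → Sigma α (0 ∷ xs) s ⇔ Sigma (α ∸ 1) xs s
Sigma-zero α xs s = mk⇔ drop-zero add-zero
  where
  drop-zero : Sigma α (0 ∷ xs) s → Sigma (α ∸ 1) xs s
  drop-zero (c , α≤c , skip p) = c , ≤-trans (m∸n≤m α 1) α≤c , p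
  drop-zero (suc c , α≤c , take p) = c , ∸-monoˡ-≤ 1 α≤c , p
  add-zero : Sigma (α ∸ 1) xs s → Sigma α (0 ∷ xs) s
  add-zero (c , α-1≤c , p) = suc c , ≤-trans (m≤n+m∸n α 1) (s≤s α-1≤c) , take p

InSigma⇔Sigma : ∀ {k} α (A : Vec ℕ k) {xs} → toList A ↭ xs → ∀ s → InSigma α A s ⇔ Sigma α xs s
InSigma⇔Sigma α A {xs} A↭xs s = mk⇔ to from
  where
  to : InSigma α A s → Sigma α xs s
  to (B , α≤ , refl) = ∣ B ∣ , α≤ , SubSum-resp-↭ A↭xs (subset→SubSum A B)
  from : Sigma α xs s → InSigma α A s
  from (c , α≤c , p) with B , refl , s≡ ← SubSum→subset A (SubSum-resp-↭ (Perm.↭-sym A↭xs) p) = B , α≤c , s≡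

select-none : ∀ xs → SubSum xs 0 0
select-none [] = none
select-none (x ∷ xs) = skip (select-none xs)

select-one : ∀ {x xs} → x ∈ₗ xs → SubSum xs 1 x
select-one {xs = x ∷ xs} (here refl) = subst (SubSum (x ∷ xs) 1) (+-identityʳ x) (take (select-none xs))
select-one (there x∈xs) = skip (select-one x∈xs)

select-all : ∀ xs → SubSum xs (length xs) (sum xs)
select-all [] = none
select-all (x ∷ xs) = take (select-all xs)

SubSum-count≤length : ∀ {xs c s} → SubSum xs c s → c ≤ length xs
SubSum-count≤length none = z≤n
SubSum-count≤length (skip p) = m≤n⇒m≤1+n (SubSum-count≤length p)
SubSum-count≤length (take p) = s≤s (SubSum-count≤length p)

SubSum-sum≤ : ∀ {xs c s} → SubSum xs c s → s ≤ sum xs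
SubSum-sum≤ none = z≤n
SubSum-sum≤ {x ∷ _} (skip p) = ≤-trans (SubSum-sum≤ p) (m≤n+m _ x)
SubSum-sum≤ {x ∷ _} (take p) = +-monoʳ-≤ x (SubSum-sum≤ p)

complement : ∀ {xs c s} → SubSum xs c s → ∃ λ v → SubSum xs (length xs ∸ c) v × v + s ≡ sum xs
complement none = 0 , none , refl
complement {x ∷ xs} {c} {s} (skip p) with v , q , v+s≡ ← complement p =
  x + v , subst (λ c′ → SubSum (x ∷ xs) c′ (x + v)) (sym (+-∸-assoc 1 (SubSum-count≤length p))) (take q) ,
  trans (+-assoc x v s) (cong (x +_) v+s≡)
complement {x ∷ xs} (take {s = s} p) with v , q , v+s≡ ← complement p =
  v , skip q , trans (x∙yz≈y∙xz v x s) (cong (x +_) v+s≡)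

m+n≡o⇒m≡o∸n : ∀ {m n o} → m + n ≡ o → m ≡ o ∸ n
m+n≡o⇒m≡o∸n {m} {n} refl = sym (m+n∸n≡m m n)

unique-⊆-length : ∀ (xs ys : List ℕ) → Unique xs → (∀ {x} → x ∈ₗ xs → x ∈ₗ ys) → length xs ≤ length ys
unique-⊆-length [] ys _ _ = z≤n
unique-⊆-length (x ∷ xs) ys (x∉xs ∷ uxs) xs⊆ys with ys₁ , ys₂ , refl ← ∈-∃++ (xs⊆ys (here refl)) =
  subst (suc (length xs) ≤_) (sym length-with-x) (s≤s (unique-⊆-length xs (ys₁ ++ ys₂) uxs xs⊆ys₁++ys₂))
  where
  length-with-x : length (ys₁ ++ x ∷ ys₂) ≡ suc (length (ys₁ ++ ys₂))
  length-with-x = trans (length-++ ys₁) (trans (+-suc (length ys₁) (length ys₂)) (cong suc (sym (length-++ ys₁))))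
  xs⊆ys₁++ys₂ : ∀ {y} → y ∈ₗ xs → y ∈ₗ ys₁ ++ ys₂
  xs⊆ys₁++ys₂ y∈xs with ∈-++⁻ ys₁ (xs⊆ys (there y∈xs))
  ... | inj₁ y∈ys₁ = ∈-++⁺ˡ y∈ys₁
  ... | inj₂ (here refl) = ⊥-elim (All.lookup x∉xs y∈xs refl)
  ... | inj₂ (there y∈ys₂) = ∈-++⁺ʳ ys₁ y∈ys₂

HasCard-resp : ∀ {P Q : ℕ → Set} {N} → (∀ x → P x ⇔ Q x) → HasCard P N → HasCard Q N
HasCard-resp P⇔Q (L , uL , lenL , L⇔P) = L , uL , lenL , λ x → ⇔-trans (L⇔P x) (P⇔Q x)

-- Saturation: if a set of cardinality N contains N distinct elements listed in
-- C, then C lists all of it (otherwise a missing element gives N + 1 of them).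
saturated : ∀ {P : ℕ → Set} {N} → HasCard P N → (C : List ℕ) → Unique C →
            (∀ {x} → x ∈ₗ C → P x) → N ≤ length C → ∀ x → P x → x ∈ₗ C
saturated {P} {N} (L , uL , lenL , L⇔P) C uC C⊆P N≤|C| x Px with x ∈ₗ? C
... | yes x∈C = x∈C
... | no x∉C = ⊥-elim (<-irrefl refl (begin-strict
      N              ≤⟨ N≤|C| ⟩
      length C       <⟨ ≤-refl ⟩
      length (x ∷ C) ≤⟨ unique-⊆-length (x ∷ C) L (All.tabulate x≢ ∷ uC) x∷C⊆L ⟩
      length L       ≡⟨ lenL ⟩
      N              ∎))
  where
  open ≤-Reasoning
  x≢ : ∀ {y} → y ∈ₗ C → x ≢ y
  x≢ y∈C refl = x∉C y∈C
  x∷C⊆L : ∀ {y} → y ∈ₗ x ∷ C → y ∈ₗ L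
  x∷C⊆L (here refl) = Equivalence.from (L⇔P x) Px
  x∷C⊆L {y} (there y∈C) = Equivalence.from (L⇔P y) (C⊆P y∈C)

applyDownFrom-unique : ∀ (f : ℕ → ℕ) m → (∀ {i j} → i < m → j < m → f i ≡ f j → i ≡ j) →
                       Unique (applyDownFrom f m)
applyDownFrom-unique f zero _ = []
applyDownFrom-unique f (suc m) f-inj =
  All.tabulate fm≢ ∷ applyDownFrom-unique f m (λ i<m j<m → f-inj (m<n⇒m<1+n i<m) (m<n⇒m<1+n j<m))
  where
  fm≢ : ∀ {x} → x ∈ₗ applyDownFrom f m → f m ≢ x
  fm≢ x∈ fm≡x with i , i<m , refl ← ∈-applyDownFrom⁻ f x∈ = <-irrefl (sym (f-inj ≤-refl (m<n⇒m<1+n i<m) fm≡x)) i<m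

triangle : ℕ → ℕ
triangle zero = 0
triangle (suc m) = suc m + triangle m

-- triangle is monotone, so triangle n ∸ triangle β is a genuine difference.
triangle-mono : ∀ {m m′} → m ≤ m′ → triangle m ≤ triangle m′
triangle-mono {m} {m′} m≤m′ with m≤n⇒m<n∨m≡n m≤m′
... | inj₂ refl = ≤-refl
... | inj₁ (s≤s m≤m′-1) = ≤-trans (triangle-mono m≤m′-1) (m≤n+m _ _)

triangle-formula : ∀ m → m * suc m / 2 ≡ triangle m
triangle-formula m = trans (cong (_/ 2) (sym (double-triangle m))) (m*n/n≡m (triangle m) 2)
  where
  double-triangle : ∀ m → triangle m * 2 ≡ m * suc m
  double-triangle zero = refl
  double-triangle (suc m) = begin
    (suc m + triangle m) * 2      ≡⟨ *-distribʳ-+ 2 (suc m) (triangle m) ⟩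
    suc m * 2 + triangle m * 2    ≡⟨ cong (suc m * 2 +_) (double-triangle m) ⟩
    suc m * 2 + m * suc m         ≡⟨ cong (_+ m * suc m) (*-comm (suc m) 2) ⟩
    2 * suc m + m * suc m         ≡⟨ *-distribʳ-+ (suc m) 2 m ⟨
    (2 + m) * suc m               ≡⟨ *-comm (2 + m) (suc m) ⟩
    suc m * suc (suc m)           ∎
    where open ≡-Reasoning

triangle-formula-pred : ∀ α → (α ∸ 1) * α / 2 ≡ triangle (α ∸ 1)
triangle-formula-pred zero = refl
triangle-formula-pred (suc α) = triangle-formula α

module Blocks (b : ℕ → ℕ) where

  block : ℕ → List ℕ
  block m = applyDownFrom (λ i → b (suc i)) m

  total : ℕ → ℕ
  total m = sum (block m)

  length-block : ∀ m → length (block m) ≡ m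
  length-block = length-applyDownFrom (λ i → b (suc i))

  select-block : ∀ m → SubSum (block m) m (total m)
  select-block m = subst (λ c → SubSum (block m) c (total m)) (length-block m) (select-all (block m))

  complement-block : ∀ {m c s} → SubSum (block m) c s → ∃ λ v → SubSum (block m) (m ∸ c) v × v + s ≡ total m
  complement-block {m} {c} p with v , q , v+s≡ ← complement p =
    v , subst (λ l → SubSum (block m) (l ∸ c) v) (length-block m) q , v+s≡

  term∈block : ∀ {i m} → 1 ≤ i → i ≤ m → b i ∈ₗ block m
  term∈block {suc i} _ i<m = ∈-applyDownFrom⁺ (λ i → b (suc i)) i<m

  select-pair : ∀ {i j m} → 1 ≤ i → i < j → j ≤ m → SubSum (block m) 2 (b j + b i)
  select-pair {m = zero} _ () z≤n
  select-pair {i} {j} {suc m} 1≤i i<j j≤1+m with m≤n⇒m<n∨m≡n j≤1+m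
  ... | inj₁ (s≤s j≤m) = skip (select-pair 1≤i i<j j≤m)
  ... | inj₂ refl = take (select-one (term∈block 1≤i (≤-pred i<j)))

  tops : ℕ → List ℕ
  tops m = applyDownFrom (λ i → total m ∸ b i) m

  -- The chain of sums from Σ_β: total β, then tops (β + 1), …, tops (β + h).
  -- It is increasing block by block, so its elements are distinct.
  chain : ℕ → ℕ → List ℕ
  chain β zero = [ total β ]
  chain β (suc h) = chain β h ++ tops (suc h + β)

module Increasing (b : ℕ → ℕ) (n : ℕ) (b-zero : b 0 ≡ 0)
                  (b-step : ∀ i → i < n → b i < b (suc i)) where

  open Blocks b

  b-< : ∀ {i j} → i < j → j ≤ n → b i < b j
  b-< {i} {suc j} (s≤s i≤j) j<n with m≤n⇒m<n∨m≡n i≤j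
  ... | inj₁ i<j = <-trans (b-< i<j (<⇒≤ j<n)) (b-step j j<n)
  ... | inj₂ refl = b-step i j<n

  b-≤ : ∀ {i j} → i ≤ j → j ≤ n → b i ≤ b j
  b-≤ i≤j j≤n with m≤n⇒m<n∨m≡n i≤j
  ... | inj₁ i<j = <⇒≤ (b-< i<j j≤n)
  ... | inj₂ refl = ≤-refl

  b-injective : ∀ {i j} → i ≤ n → j ≤ n → b i ≡ b j → i ≡ j
  b-injective {i} {j} i≤n j≤n bi≡bj with <-cmp i j
  ... | tri< i<j _ _ = ⊥-elim (<⇒≢ (b-< i<j j≤n) bi≡bj)
  ... | tri≈ _ i≡j _ = i≡j
  ... | tri> _ _ j<i = ⊥-elim (<⇒≢ (b-< j<i i≤n) (sym bi≡bj))

  b-reflects-< : ∀ {i j} → i ≤ n → b i < b j → i < j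
  b-reflects-< i≤n bi<bj = ≰⇒> (λ j≤i → <⇒≱ bi<bj (b-≤ j≤i i≤n))

  select-term : ∀ {i m} → i ≤ m → ∃ λ c → c ≤ 1 × SubSum (block m) c (b i)
  select-term {zero} _ = 0 , z≤n , subst (SubSum _ 0) (sym b-zero) (select-none _)
  select-term {suc i} i≤m = 1 , ≤-refl , select-one (term∈block (s≤s z≤n) i≤m)

  term≤total : ∀ {i m} → i ≤ m → b i ≤ total m
  term≤total i≤m with _ , _ , p ← select-term i≤m = SubSum-sum≤ p

  remove-term : ∀ {i m} → i ≤ m → ∃ λ c → m ∸ 1 ≤ c × SubSum (block m) c (total m ∸ b i)
  remove-term {i} {m} i≤m with c , c≤1 , p ← select-term i≤m = remove (complement-block p)
    where
    remove : (∃ λ v → SubSum (block m) (m ∸ c) v × v + b i ≡ total m) →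
             ∃ λ c′ → m ∸ 1 ≤ c′ × SubSum (block m) c′ (total m ∸ b i)
    remove (v , q , v+bi≡) = m ∸ c , ∸-monoʳ-≤ m c≤1 , subst (SubSum _ _) (m+n≡o⇒m≡o∸n v+bi≡) q

  minus-term-Sigma : ∀ {β m i} → β < m → i < m → Sigma β (block m) (total m ∸ b i)
  minus-term-Sigma β<m i<m with c , m-1≤c , p ← remove-term (<⇒≤ i<m) = c , ≤-trans (∸-monoˡ-≤ 1 β<m) m-1≤c , p

  chain-Sigma : ∀ β h {x} → x ∈ₗ chain β h → Sigma β (block (h + β)) x
  chain-Sigma β zero (here refl) = β , ≤-refl , select-block β
  chain-Sigma β (suc h) x∈ with ∈-++⁻ (chain β h) x∈
  ... | inj₁ x∈chain with c , β≤c , p ← chain-Sigma β h x∈chain = c , β≤c , skip p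
  ... | inj₂ x∈tops with i , i<m , refl ← ∈-applyDownFrom⁻ _ x∈tops = minus-term-Sigma (s≤s (m≤n+m β h)) i<m

  chain-bound : ∀ β h {x} → x ∈ₗ chain β h → x ≤ total (h + β)
  chain-bound β zero (here refl) = ≤-refl
  chain-bound β (suc h) x∈ with ∈-++⁻ (chain β h) x∈
  ... | inj₁ x∈chain = ≤-trans (chain-bound β h x∈chain) (m≤n+m _ _)
  ... | inj₂ x∈tops with i , _ , refl ← ∈-applyDownFrom⁻ _ x∈tops = m∸n≤m _ (b i)

  tops-above : ∀ {m i} → suc m ≤ n → i < suc m → total m < total (suc m) ∸ b i
  tops-above {m} {i} m<n i<1+m = subst (total m <_) (sym (+-∸-comm (total m) (<⇒≤ bi<))) (m<n+m (total m) (m<n⇒0<n∸m bi<))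
    where
    bi< : b i < b (suc m)
    bi< = b-< i<1+m m<n

  tops-unique : ∀ m → m ≤ n → Unique (tops m)
  tops-unique m m≤n = applyDownFrom-unique _ m distinct
    where
    distinct : ∀ {i j} → i < m → j < m → total m ∸ b i ≡ total m ∸ b j → i ≡ j
    distinct {i} {j} i<m j<m e = b-injective (≤-trans (<⇒≤ i<m) m≤n) (≤-trans (<⇒≤ j<m) m≤n)
      (+-cancelˡ-≡ (total m ∸ b i) _ _ (begin
        total m ∸ b i + b i ≡⟨ m∸n+n≡m (term≤total (<⇒≤ i<m)) ⟩
        total m             ≡⟨ m∸n+n≡m (term≤total (<⇒≤ j<m)) ⟨
        total m ∸ b j + b j ≡⟨ cong (_+ b j) e ⟨
        total m ∸ b i + b j ∎))
      where open ≡-Reasoning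

  chain-unique : ∀ β h → h + β ≤ n → Unique (chain β h)
  chain-unique β zero _ = [] ∷ []
  chain-unique β (suc h) h+β<n =
    ++⁺ (chain-unique β h (<⇒≤ h+β<n)) (tops-unique (suc h + β) h+β<n) disjoint
    where
    disjoint : ∀ {x} → ¬ (x ∈ₗ chain β h × x ∈ₗ tops (suc h + β))
    disjoint (x∈chain , x∈tops) with i , i<m , refl ← ∈-applyDownFrom⁻ _ x∈tops =
      <⇒≱ (tops-above h+β<n i<m) (chain-bound β h x∈chain)

  chain-length : ∀ β h → length (chain β h) + triangle β ≡ triangle (h + β) + 1
  chain-length β zero = +-comm 1 (triangle β)
  chain-length β (suc h) = begin
    length (chain β h ++ tops m) + triangle β ≡⟨ cong (_+ triangle β) (length-++ (chain β h)) ⟩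
    L + length (tops m) + triangle β         ≡⟨ cong (λ l → L + l + triangle β) (length-applyDownFrom _ m) ⟩
    L + m + triangle β                       ≡⟨ cong (_+ triangle β) (+-comm L m) ⟩
    m + L + triangle β                       ≡⟨ +-assoc m L (triangle β) ⟩
    m + (L + triangle β)                     ≡⟨ cong (m +_) (chain-length β h) ⟩
    m + (triangle (h + β) + 1)               ≡⟨ +-assoc m _ 1 ⟨
    triangle m + 1                           ∎
    where
    open ≡-Reasoning
    m = suc h + β
    L = length (chain β h)

module Extremal (b : ℕ → ℕ) (β g : ℕ) (b-zero : b 0 ≡ 0)
                (b-step : ∀ i → i < suc (suc (g + β)) → b i < b (suc i))
                (2≤g+β : 2 ≤ g + β)
                (card : HasCard (Sigma β (Blocks.block b (suc (suc (g + β)))))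
                                (triangle (suc (suc (g + β))) ∸ triangle β + 1)) where

  open Blocks b

  n m₁ : ℕ
  n = suc (suc (g + β))
  m₁ = suc (g + β)

  open Increasing b n b-zero b-step

  Sigma⊆chain : ∀ {x} → Sigma β (block n) x → x ∈ₗ chain β (suc (suc g))
  Sigma⊆chain {x} = saturated card C (chain-unique β (suc (suc g)) ≤-refl) (chain-Sigma β (suc (suc g))) N≤|C| x
    where
    C = chain β (suc (suc g))
    N≤|C| : triangle n ∸ triangle β + 1 ≤ length C
    N≤|C| = ≤-reflexive (begin
      triangle n ∸ triangle β + 1 ≡⟨ +-∸-comm 1 (triangle-mono (m≤n+m β (suc (suc g)))) ⟨
      triangle n + 1 ∸ triangle β ≡⟨ m+n≡o⇒m≡o∸n (chain-length β (suc (suc g))) ⟨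
      length C ∎)
      where open ≡-Reasoning

  -- Removing two terms b i, b j (1 ≤ i < j ≤ n) leaves n - 2 ≥ β terms.
  remove-pair : ∀ {i j} → 1 ≤ i → i < j → j ≤ n → ∃ λ v → Sigma β (block n) v × v + (b i + b j) ≡ total n
  remove-pair {i} {j} 1≤i i<j j≤n with v , q , v+bj+bi≡ ← complement-block (select-pair 1≤i i<j j≤n) =
    v , (g + β , m≤n+m β g , q) , trans (cong (v +_) (+-comm (b i) (b j))) v+bj+bi≡

  -- A sum of two terms below b m₁ + b n is a term, or b n plus a term: the
  -- complement of the pair lies in the chain, and not below its last two
  -- blocks, since those elements are at most total (g + β).
  two-term-sum : ∀ {i j} → 1 ≤ i → i < j → j ≤ n → b i + b j < b m₁ + b n →
                 (∃ λ l → l < n × b i + b j ≡ b l) ⊎ (∃ λ l → l < m₁ × b i + b j ≡ b n + b l)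
  two-term-sum {i} {j} 1≤i i<j j≤n small with v , v∈Σ , v+s≡ ← remove-pair 1≤i i<j j≤n
                                            | ∈-++⁻ (chain β g ++ tops m₁) (Sigma⊆chain v∈Σ)
  ... | inj₂ v∈topsₙ with l , l<n , refl ← ∈-applyDownFrom⁻ _ v∈topsₙ =
    inj₁ (l , l<n , +-cancelˡ-≡ v _ _ (trans v+s≡ (sym (m∸n+n≡m (term≤total (<⇒≤ l<n))))))
  ... | inj₁ v∈ with ∈-++⁻ (chain β g) v∈
  ...   | inj₂ v∈topsₘ₁ with l , l<m₁ , refl ← ∈-applyDownFrom⁻ _ v∈topsₘ₁ =
    inj₂ (l , l<m₁ , +-cancelˡ-≡ v _ _ (begin
      v + (b i + b j)       ≡⟨ v+s≡ ⟩
      b n + total m₁        ≡⟨ cong (b n +_) (m∸n+n≡m (term≤total (<⇒≤ l<m₁))) ⟨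
      b n + (v + b l)       ≡⟨ x∙yz≈y∙xz (b n) v (b l) ⟩
      v + (b n + b l)       ∎))
    where open ≡-Reasoning
  ...   | inj₁ v∈chain = ⊥-elim (<-irrefl refl (begin-strict
      total n                               ≡⟨ v+s≡ ⟨
      v + (b i + b j)                       <⟨ +-mono-≤-< (chain-bound β g v∈chain) small ⟩
      total (g + β) + (b m₁ + b n)          ≡⟨ x∙yz≈y∙xz (total (g + β)) (b m₁) (b n) ⟩
      b m₁ + (total (g + β) + b n)          ≡⟨ cong (b m₁ +_) (+-comm (total (g + β)) (b n)) ⟩
      b m₁ + (b n + total (g + β))          ≡⟨ x∙yz≈y∙xz (b m₁) (b n) _ ⟩
      total n                               ∎))
    where open ≤-Reasoning

  2<m₁ : 2 < m₁
  2<m₁ = s≤s 2≤g+β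

  <m₁⇒≤n : ∀ {l} → l < m₁ → l ≤ n
  <m₁⇒≤n l<m₁ = <⇒≤ (m<n⇒m<1+n l<m₁)

  b₁-positive : 0 < b 1
  b₁-positive = subst (_< b 1) b-zero (b-step 0 (s≤s z≤n))

  b₁<b₂ : b 1 < b 2
  b₁<b₂ = b-< ≤-refl (<m₁⇒≤n 2<m₁)

  b₁+b-below : ∀ {j} → j < n → b 1 + b j < b m₁ + b n
  b₁+b-below j<n = +-mono-<-≤ (b-< (<-trans ≤-refl 2<m₁) (n≤1+n m₁)) (b-≤ (<⇒≤ j<n) ≤-refl)

  b₂+bₘ₁-below : b 2 + b m₁ < b m₁ + b n
  b₂+bₘ₁-below = subst (b 2 + b m₁ <_) (+-comm (b n) (b m₁)) (+-monoˡ-< (b m₁) (b-< (m<n⇒m<1+n 2<m₁) ≤-refl))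

  plus-b₁ : ∀ {j} → 2 ≤ j → j < n → ∃ λ l → j < l × l ≤ n × b 1 + b j ≡ b l
  plus-b₁ {j} 2≤j j<n with two-term-sum ≤-refl 2≤j (<⇒≤ j<n) (b₁+b-below j<n)
  ... | inj₁ (l , l<n , e) = l , b-reflects-< (<⇒≤ j<n) (subst (b j <_) e (m<n+m (b j) b₁-positive)) , <⇒≤ l<n , e
  ... | inj₂ (zero , _ , e) = n , j<n , ≤-refl , trans e (trans (cong (b n +_) b-zero) (+-identityʳ (b n)))
  ... | inj₂ (suc l , l<m₁ , e) =
    ⊥-elim (<⇒≢ (+-mono-≤-< (b-≤ (s≤s z≤n) (<m₁⇒≤n l<m₁)) (b-< j<n ≤-refl)) (trans e (+-comm (b n) (b (suc l)))))

  -- Hence consecutive terms from b 2 on differ by b 1: the later term b l of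
  -- plus-b₁ must be b (j + 1). Downward induction on j, with r bounding n - j.
  step-b₁-within : ∀ r {j} → n ≤ j + suc r → 2 ≤ j → j < n → b (suc j) ≡ b j + b 1
  no-later-term : ∀ r {j l} → n ≤ j + suc r → 2 ≤ j → j < n → suc j < l → l ≤ n → b 1 + b j ≢ b l

  step-b₁-within r {j} n≤j+r+1 2≤j j<n with plus-b₁ 2≤j j<n
  ... | l , j<l , l≤n , b₁+bj≡bl with m≤n⇒m<n∨m≡n j<l
  ...   | inj₂ refl = trans (sym b₁+bj≡bl) (+-comm (b 1) (b j))
  ...   | inj₁ j+1<l = ⊥-elim (no-later-term r n≤j+r+1 2≤j j<n j+1<l l≤n b₁+bj≡bl)

  no-later-term zero {j} n≤j+1 _ _ j+1<l l≤n _ =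
    <-irrefl refl (≤-trans j+1<l (≤-trans l≤n (subst (n ≤_) (+-comm j 1) n≤j+1)))
  no-later-term (suc r) {j} {suc l} n≤j+r+2 2≤j j<n (s≤s j<l) l+1≤n b₁+bj≡bl+1 = <-irrefl j≡l j<l
    where
    step-l : b (suc l) ≡ b l + b 1
    step-l = step-b₁-within r (≤-trans n≤j+r+2 (subst (_≤ l + suc r) (sym (+-suc j (suc r))) (+-monoˡ-≤ (suc r) j<l)))
                           (≤-trans 2≤j (<⇒≤ j<l)) l+1≤n
    j≡l : j ≡ l
    j≡l = b-injective (<⇒≤ j<n) (≤-trans (n≤1+n l) l+1≤n)
            (+-cancelʳ-≡ (b 1) _ _ (trans (+-comm (b j) (b 1)) (trans b₁+bj≡bl+1 step-l)))

  step-b₁ : ∀ {j} → 2 ≤ j → j < n → b (suc j) ≡ b j + b 1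
  step-b₁ {j} = step-b₁-within n (≤-trans (n≤1+n n) (m≤n+m (suc n) j))

  bₙ : b n ≡ b m₁ + b 1
  bₙ = step-b₁ (≤-trans 2≤g+β (n≤1+n _)) ≤-refl

  b₂ : b 2 ≡ b 1 + b 1
  b₂ with two-term-sum (s≤s z≤n) 2<m₁ (n≤1+n m₁) b₂+bₘ₁-below
  ... | inj₁ (l , l<n , e) = ⊥-elim (<-asym (+-monoʳ-< (b m₁) b₁<b₂) (begin-strict
      b m₁ + b 2   ≡⟨ +-comm (b m₁) (b 2) ⟩
      b 2 + b m₁   ≡⟨ e ⟩
      b l          <⟨ b-< l<n ≤-refl ⟩
      b n          ≡⟨ bₙ ⟩
      b m₁ + b 1   ∎))
    where open ≤-Reasoning
  ... | inj₂ (l , l<m₁ , e) = b₂-from l l<m₁ (+-cancelˡ-≡ (b m₁) _ _ (begin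
      b m₁ + b 2        ≡⟨ +-comm (b m₁) (b 2) ⟩
      b 2 + b m₁        ≡⟨ e ⟩
      b n + b l         ≡⟨ cong (_+ b l) bₙ ⟩
      b m₁ + b 1 + b l  ≡⟨ +-assoc (b m₁) (b 1) (b l) ⟩
      b m₁ + (b 1 + b l) ∎))
    where
    open ≡-Reasoning
    b₂-from : ∀ l → l < m₁ → b 2 ≡ b 1 + b l → b 2 ≡ b 1 + b 1
    b₂-from zero _ e = ⊥-elim (<⇒≢ b₁<b₂ (sym (trans e (trans (cong (b 1 +_) b-zero) (+-identityʳ (b 1))))))
    b₂-from (suc zero) _ e = e
    b₂-from (suc (suc l)) l<m₁ e = ⊥-elim (<-irrefl e (+-mono-<-≤ b₁-positive (b-≤ (s≤s (s≤s z≤n)) (<m₁⇒≤n l<m₁))))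

  b-step-is-b₁ : ∀ {i} → i < n → b (suc i) ≡ b i + b 1
  b-step-is-b₁ {zero} _ = cong (_+ b 1) (sym b-zero)
  b-step-is-b₁ {suc zero} _ = b₂
  b-step-is-b₁ {suc (suc j)} = step-b₁ (s≤s (s≤s z≤n))

  arithmetic : ∀ i → i ≤ n → b i ≡ i * b 1
  arithmetic zero _ = b-zero
  arithmetic (suc i) i<n = begin
    b (suc i)       ≡⟨ b-step-is-b₁ i<n ⟩
    b i + b 1       ≡⟨ cong (_+ b 1) (arithmetic i (<⇒≤ i<n)) ⟩
    i * b 1 + b 1   ≡⟨ +-comm (i * b 1) (b 1) ⟩
    suc i * b 1     ∎
    where open ≡-Reasoning

extremal-arithmetic : ∀ (b : ℕ → ℕ) β g n → n ≡ suc (suc (g + β)) → b 0 ≡ 0 → (∀ i → i < n → b i < b (suc i)) →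
                      2 ≤ g + β → HasCard (Sigma β (Blocks.block b n)) (triangle n ∸ triangle β + 1) →
                      ∀ i → i ≤ n → b i ≡ i * b 1
extremal-arithmetic b β g _ refl b-zero b-step 2≤g+β card = Extremal.arithmetic b β g b-zero b-step 2≤g+β card

applyUpTo↭applyDownFrom : ∀ (f : ℕ → ℕ) n → applyUpTo f n ↭ applyDownFrom f n
applyUpTo↭applyDownFrom f n = subst (applyUpTo f n ↭_) (reverse-applyUpTo f n) (Perm.↭-sym (↭-reverse (applyUpTo f n)))

-- entry zs i : the i-th entry of zs (0 past the end).
entry : List ℕ → ℕ → ℕ
entry [] _ = 0
entry (z ∷ zs) zero = z
entry (z ∷ zs) (suc i) = entry zs i

list-as-applyUpTo : ∀ zs → zs ≡ applyUpTo (entry zs) (length zs)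
list-as-applyUpTo [] = refl
list-as-applyUpTo (z ∷ zs) = cong (z ∷_) (list-as-applyUpTo zs)

sorted-entry-< : ∀ zs → Linked _≤_ zs → Unique zs → ∀ i → suc i < length zs → entry zs i < entry zs (suc i)
sorted-entry-< (z ∷ z′ ∷ zs) (z≤z′ ∷ _) ((z≢z′ ∷ _) ∷ _) zero _ = ≤∧≢⇒< z≤z′ z≢z′
sorted-entry-< (z ∷ z′ ∷ zs) (_ ∷ sorted) (_ ∷ unique) (suc i) (s≤s i<) = sorted-entry-< (z′ ∷ zs) sorted unique i i<
sorted-entry-< (z ∷ []) _ _ i (s≤s ())

sorted-entry-min : ∀ zs → Linked _≤_ zs → ∀ {x} → x ∈ₗ zs → entry zs 0 ≤ x
sorted-entry-min (z ∷ zs) _ (here refl) = ≤-refl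
sorted-entry-min (z ∷ z′ ∷ zs) (z≤z′ ∷ sorted) (there x∈) = ≤-trans z≤z′ (sorted-entry-min (z′ ∷ zs) sorted x∈)

record IncreasingEnumeration (n : ℕ) (xs : List ℕ) : Set where
  field
    b : ℕ → ℕ
    b-zero : b 0 ≡ 0
    b-step : ∀ i → i < n → b i < b (suc i)
    enumerates : xs ↭ applyUpTo b (suc n)

  enumerates-blocks : xs ↭ 0 ∷ Blocks.block b n
  enumerates-blocks = Perm.↭-trans enumerates (Perm.↭-trans (Perm.↭-reflexive (cong (_∷ positives) b-zero))
                                                            (prep 0 (applyUpTo↭applyDownFrom (λ i → b (suc i)) n)))
    where
    positives = applyUpTo (λ i → b (suc i)) n

  membership : ∀ x → x ∈ₗ xs ⇔ (∃ λ i → i ≤ n × x ≡ b i)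
  membership x = mk⇔ to from
    where
    to : x ∈ₗ xs → ∃ λ i → i ≤ n × x ≡ b i
    to x∈xs with i , s≤s i≤n , x≡bi ← ∈-applyUpTo⁻ b (Any-resp-↭ enumerates x∈xs) = i , i≤n , x≡bi
    from : (∃ λ i → i ≤ n × x ≡ b i) → x ∈ₗ xs
    from (i , i≤n , refl) = Any-resp-↭ (Perm.↭-sym enumerates) (∈-applyUpTo⁺ b (s≤s i≤n))

enumerate : ∀ n xs → Unique xs → 0 ∈ₗ xs → length xs ≡ suc n → IncreasingEnumeration n xs
enumerate n xs unique 0∈xs |xs| = record
  { b = entry ys
  ; b-zero = n≤0⇒n≡0 (sorted-entry-min ys (sort-↗ xs) (Any-resp-↭ xs↭ys 0∈xs))
  ; b-step = λ i i<n → sorted-entry-< ys (sort-↗ xs) unique-ys i (subst (suc (suc i) ≤_) (sym |ys|) (s≤s i<n))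
  ; enumerates = Perm.↭-trans xs↭ys (Perm.↭-reflexive (trans (list-as-applyUpTo ys) (cong (applyUpTo (entry ys)) |ys|)))
  }
  where
  ys = sort xs
  xs↭ys : xs ↭ ys
  xs↭ys = Perm.↭-sym (sort-↭ xs)
  |ys| : length ys ≡ suc n
  |ys| = trans (sym (↭-length xs↭ys)) |xs|
  unique-ys : Unique ys
  unique-ys = Unique-resp-↭ (↭⇒↭ₛ xs↭ys) unique

distinct-toList : ∀ {k} {A : Vec ℕ k} → AllPairs _≢_ A → Unique (toList A)
distinct-toList AllPairs.[] = []
distinct-toList (x≢ AllPairs.∷ distinct) = VecAll.toList⁺ x≢ ∷ distinct-toList distinct

progression-terms : ∀ (b : ℕ → ℕ) d n → (∀ i → i ≤ n → b i ≡ i * d) →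
                    ∀ x → (∃ λ i → i ≤ n × x ≡ b i) ⇔ (∃ λ i → i ≤ n × x ≡ d * i)
progression-terms b d n b≡id x = mk⇔
  (λ (i , i≤n , x≡bi) → i , i≤n , trans x≡bi (trans (b≡id i i≤n) (*-comm i d)))
  (λ (i , i≤n , x≡di) → i , i≤n , trans x≡di (trans (*-comm d i) (sym (b≡id i i≤n))))

corollary2p3 : (k α : ℕ) → 5 ≤ k → α ≤ k ∸ 2 →
    (A : Vec ℕ k) → AllPairs _≢_ A → 0 ∈ A →
    HasCard (InSigma α A) ((k ∸ 1) * k / 2 ∸ (α ∸ 1) * α / 2 + 1) →
    Σ ℕ λ d → (0 < d) × (∀ x → (x ∈ A) ⇔ (Σ ℕ λ i → (i ≤ k ∸ 1) × (x ≡ d * i)))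
corollary2p3 (suc (suc (suc m))) α (s≤s (s≤s (s≤s 2≤m))) α≤1+m A distinct 0∈A card =
  b 1 , subst (_< b 1) b-zero (b-step 0 (s≤s z≤n)) ,
  λ x → ⇔-trans (mk⇔ ∈-toList⁺ ∈-toList⁻) (⇔-trans (membership x) (progression-terms b (b 1) (2 + m) b-arithmetic x))
  where
  open IncreasingEnumeration (enumerate (2 + m) (toList A) (distinct-toList distinct) (∈-toList⁺ 0∈A) (length-toList A))
  β = α ∸ 1
  g+β≡m : m ∸ β + β ≡ m
  g+β≡m = m∸n+n≡m (∸-monoˡ-≤ 1 α≤1+m)
  card-blocks : HasCard (Sigma β (Blocks.block b (2 + m))) (triangle (2 + m) ∸ triangle β + 1)
  card-blocks = HasCard-resp (λ s → ⇔-trans (InSigma⇔Sigma α A enumerates-blocks s) (Sigma-zero α _ s))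
    (subst (HasCard (InSigma α A)) (cong₂ (λ t t′ → t ∸ t′ + 1) (triangle-formula (2 + m)) (triangle-formula-pred α)) card)
  b-arithmetic : ∀ i → i ≤ 2 + m → b i ≡ i * b 1
  b-arithmetic = extremal-arithmetic b β (m ∸ β) (2 + m) (cong (2 +_) (sym g+β≡m)) b-zero b-step
                                     (subst (2 ≤_) (sym g+β≡m) 2≤m) card-blocks
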